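{- Let $c$ and $n$ be positive integers and let $F$ be a perfect matching of $K_{2nc}$ such that $\ell(F)=\{c^{b_1},(2c)^{b_2},\ldots,(nc)^{b_n}\}$, where $b_j\geq 0$. Then there exist $c$ (not necessarily distinct) perfect matchings $F_0,F_1,\ldots,F_{c-1}$ of $K_{2n}$ such that $\ell(F_i)=\{1^{a_{i,1}},2^{a_{i,2}},\ldots,n^{a_{i,n}}\}$, where $a_{i,j}\geq 0$ and $b_j=\sum_{i=0}^{c-1}a_{i,j}$ for each $j\in[1,n]$.
   Context: For a positive integer $v$, $K_v$ denotes the complete graph on the vertex set $\{0,1,\ldots,v-1\}$. The length of an edge $\{u,w\}$ of $K_v$ is $\ell(u,w)=\min(|u-w|,\,v-|u-w|)$. For a subgraph $\Gamma$ of $K_v$, $\ell(\Gamma)$ is the list (multiset) of lengths of all edges of $\Gamma$, counted with multiplicity. A perfect matching of $K_{2m}$ is a set of $m$ pairwise disjoint edges covering all vertices. The notation $\{z_1^{e_1},\ldots,z_k^{e_k}\}$ denotes the list containing $e_i$ copies of $z_i$ for each $i$. -}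

module Defs where

open import Data.Nat using (ℕ; suc; _<_; _*_; _∸_; ∣_-_∣; _⊓_)
open import Data.Product using (_×_; _,_; ∃)
open import Data.Sum using (_⊎_)
open import Data.List using (List; map; concatMap; replicate; applyUpTo)
open import Data.List.Relation.Unary.All using (All)
open import Data.List.Relation.Unary.AllPairs using (AllPairs)
open import Data.List.Membership.Propositional using (_∈_)
open import Relation.Binary.PropositionalEquality using (_≡_; _≢_)
open import Relation.Nullary using (¬_)

Edge : Set
Edge = ℕ × ℕ

IsEdge : ℕ → Edge → Set
IsEdge v (u , w) = u < v × w < v × u ≢ w

_∈ₑ_ : ℕ → Edge → Set
x ∈ₑ (u , w) = x ≡ u ⊎ x ≡ w

DisjointEdges : Edge → Edge → Set
DisjointEdges e f = ∀ x → x ∈ₑ e → ¬ (x ∈ₑ f)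

IsPerfectMatching : ℕ → List Edge → Set
IsPerfectMatching v F =
  All (IsEdge v) F × AllPairs DisjointEdges F × (∀ x → x < v → ∃ λ e → e ∈ F × x ∈ₑ e)

ℓ : ℕ → Edge → ℕ
ℓ v (u , w) = ∣ u - w ∣ ⊓ (v ∸ ∣ u - w ∣)

lengths : ℕ → List Edge → List ℕ
lengths v F = map (ℓ v) F

mulList : ℕ → ℕ → (ℕ → ℕ) → List ℕ
mulList c n e = concatMap (λ j → replicate (e j) (j * c)) (applyUpTo suc n)

-- Every length in ℓ(F) is a multiple of c, and the cyclic length of an edge {u,w} of K_{2nc} is
-- ∣u − w∣ or 2nc − ∣u − w∣, so the two ends of every edge of F are congruent modulo c.  Hence F
-- splits by the residue r of its vertices.  The map y ↦ ⌊y/c⌋ is a bijection from the vertices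
-- ≡ r (mod c) onto those of K_{2n} which divides all differences, hence all lengths, by c; so the
-- edges of class r become a perfect matching F_r of K_{2n}, and each edge of length jc in F becomes
-- an edge of length j in exactly one F_r, which is b_j = Σ_r a_{r,j}.
module Submission where

open import Defs
open import Data.Nat
open import Data.Nat.Properties
open import Data.Nat.DivMod
open import Data.Nat.Divisibility using (n∣m*n)
open import Data.Nat.ListAction using (sum)
open import Data.Nat.ListAction.Properties using (sum-++; sum-↭)
open import Data.Fin as Fin using (Fin; toℕ)
open import Data.Fin.Properties using (toℕ<n)
open import Data.List using (List; []; _∷_; _++_; [_]; map; filter; replicate; applyUpTo; concatMap; allFin)
open import Data.List.Properties
  using (map-++; map-∘; map-cong; map-cong-local; map-tabulate; concatMap-++; applyUpTo-∷ʳ; ++-identityʳ;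
         filter-++; filter-accept; filter-reject)
open import Data.List.Membership.Propositional using (_∈_; _∉_)
open import Data.List.Membership.Propositional.Properties using (∈-∃++; ∈-++⁻; ∈-map⁺; ∈-filter⁺)
open import Data.List.Membership.DecPropositional _≟_ using (_∈?_)
open import Data.List.Relation.Unary.Any using (here; there)
open import Data.List.Relation.Unary.All as All using (All; []; _∷_)
open import Data.List.Relation.Unary.All.Properties as Allₚ using (all-filter; replicate⁺)
open import Data.List.Relation.Unary.AllPairs using (AllPairs; []; _∷_)
import Data.List.Relation.Unary.AllPairs.Properties as AllPairsₚ
open import Data.List.Relation.Binary.Permutation.Propositional using (_↭_; ↭-refl; ↭-sym; ↭-trans; prep)
open import Data.List.Relation.Binary.Permutation.Propositional.Properties using (shift; map⁺; ∈-resp-↭)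
open import Data.Product using (Σ; _×_; _,_; ∃; ∃-syntax; proj₁; proj₂)
open import Data.Sum as Sum using (inj₁; inj₂)
open import Function using (_∘_)
open import Relation.Nullary using (Dec; yes; no; contradiction)
open import Relation.Nullary.Decidable using (_×-dec_)
open import Relation.Binary.PropositionalEquality hiding ([_])
open import Algebra.Properties.CommutativeSemigroup +-commutativeSemigroup using (interchange)

δ : ℕ → ℕ → ℕ
δ x y with x ≟ y
... | yes _ = 1
... | no _  = 0

δ-refl : ∀ x → δ x x ≡ 1
δ-refl x with x ≟ x
... | yes _  = refl
... | no x≢x = contradiction refl x≢x

δ-≢ : ∀ {x y} → x ≢ y → δ x y ≡ 0
δ-≢ {x} {y} x≢y with x ≟ y
... | yes x≡y = contradiction x≡y x≢y
... | no _    = refl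

δ-*-cancelʳ : ∀ c .{{_ : NonZero c}} x y → δ (x * c) (y * c) ≡ δ x y
δ-*-cancelʳ c x y with x ≟ y
... | yes refl = δ-refl (x * c)
... | no x≢y   = δ-≢ (x≢y ∘ *-cancelʳ-≡ x y c)

count : ℕ → List ℕ → ℕ
count x xs = sum (map (δ x) xs)

count-↭ : ∀ {x xs ys} → xs ↭ ys → count x xs ≡ count x ys
count-↭ {x} p = sum-↭ (map⁺ (δ x) p)

count-++ : ∀ x xs ys → count x (xs ++ ys) ≡ count x xs + count x ys
count-++ x xs ys = trans (cong sum (map-++ (δ x) xs ys)) (sum-++ (map (δ x) xs) (map (δ x) ys))

count-map : ∀ {A : Set} x (f : A → ℕ) xs → count x (map f xs) ≡ sum (map (δ x ∘ f) xs)
count-map x f xs = cong sum (sym (map-∘ xs))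

count-replicate-self : ∀ x k → count x (replicate k x) ≡ k
count-replicate-self x zero    = refl
count-replicate-self x (suc k) = cong₂ _+_ (δ-refl x) (count-replicate-self x k)

count-∉ : ∀ {x xs} → x ∉ xs → count x xs ≡ 0
count-∉ {xs = []}         _  = refl
count-∉ {x} {y ∷ xs} x∉ = cong₂ _+_ (δ-≢ (x∉ ∘ here)) (count-∉ (x∉ ∘ there))

count≢0⇒∈ : ∀ {x xs} → count x xs ≢ 0 → x ∈ xs
count≢0⇒∈ {x} {xs} count≢0 with x ∈? xs
... | yes x∈ = x∈
... | no x∉  = contradiction (count-∉ x∉) count≢0

↭-by-count : ∀ {xs ys} → (∀ x → count x xs ≡ count x ys) → xs ↭ ys
↭-by-count {[]} {[]}     _    = ↭-refl
↭-by-count {[]} {y ∷ ys} same = contradiction (trans (same y) (cong (_+ count y ys) (δ-refl y))) 0≢1+n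
↭-by-count {y ∷ xs} {ys} same with ∈-∃++ y∈ys
  where
  y∈ys : y ∈ ys
  y∈ys = count≢0⇒∈ λ none → 0≢1+n (trans (sym none) (trans (sym (same y)) (cong (_+ count y xs) (δ-refl y))))
... | us , vs , refl = ↭-trans (prep y (↭-by-count same′)) (↭-sym (shift y us vs))
  where
  same′ : ∀ x → count x xs ≡ count x (us ++ vs)
  same′ x = +-cancelˡ-≡ (δ x y) _ _ (trans (same x) (count-↭ (shift y us vs)))

∈-replicate⁻ : ∀ {A : Set} {x y : A} {k} → x ∈ replicate k y → x ≡ y
∈-replicate⁻ {y = y} {k} = All.lookup (replicate⁺ {P = _≡ y} k refl)

InRange : ℕ → ℕ → Set
InRange n x = 1 ≤ x × x ≤ n

mulList-suc : ∀ c n e → mulList c (suc n) e ≡ mulList c n e ++ replicate (e (suc n)) (suc n * c)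
mulList-suc c n e = begin
  concatMap f (applyUpTo suc (suc n))        ≡⟨ cong (concatMap f) (applyUpTo-∷ʳ suc n) ⟨
  concatMap f (applyUpTo suc n ++ [ suc n ]) ≡⟨ concatMap-++ f (applyUpTo suc n) [ suc n ] ⟩
  mulList c n e ++ f (suc n) ++ []           ≡⟨ cong (mulList c n e ++_) (++-identityʳ (f (suc n))) ⟩
  mulList c n e ++ f (suc n)                 ∎
  where
  open ≡-Reasoning
  f = λ j → replicate (e j) (j * c)

∈-mulList⁻ : ∀ {c n e x} → x ∈ mulList c n e → ∃[ j ] (InRange n j × x ≡ j * c)
∈-mulList⁻ {n = zero} ()
∈-mulList⁻ {c} {suc n} {e} x∈ with ∈-++⁻ (mulList c n e) (subst (_ ∈_) (mulList-suc c n e) x∈)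
... | inj₁ x∈′ with ∈-mulList⁻ x∈′
...   | j , (1≤j , j≤n) , x≡jc = j , (1≤j , m≤n⇒m≤1+n j≤n) , x≡jc
∈-mulList⁻ {c} {suc n} {e} x∈ | inj₂ x∈′ = suc n , (s≤s z≤n , ≤-refl) , ∈-replicate⁻ x∈′

count-mulList-suc : ∀ x c n e →
  count x (mulList c (suc n) e) ≡ count x (mulList c n e) + count x (replicate (e (suc n)) (suc n * c))
count-mulList-suc x c n e = trans (cong (count x) (mulList-suc c n e)) (count-++ x (mulList c n e) _)

count-mulList : ∀ {c} .{{_ : NonZero c}} {n} e {j} → InRange n j → count (j * c) (mulList c n e) ≡ e j
count-mulList {n = zero} e (s≤s _ , ())
count-mulList {c} {suc n} e {j} (1≤j , j≤1+n) with j ≟ suc n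
... | yes refl =
  trans (count-mulList-suc (j * c) c n e) (cong₂ _+_ (count-∉ old∉) (count-replicate-self (j * c) (e j)))
  where
  old∉ : j * c ∉ mulList c n e
  old∉ x∈ with ∈-mulList⁻ x∈
  ... | i , (_ , i≤n) , jc≡ic = 1+n≰n (subst (_≤ n) (sym (*-cancelʳ-≡ j i c jc≡ic)) i≤n)
... | no j≢1+n = begin
  count (j * c) (mulList c (suc n) e)               ≡⟨ count-mulList-suc (j * c) c n e ⟩
  count (j * c) (mulList c n e) + count (j * c) new ≡⟨ cong₂ _+_ (count-mulList e (1≤j , j≤n)) (count-∉ new∉) ⟩
  e j + 0                                           ≡⟨ +-identityʳ (e j) ⟩
  e j                                               ∎
  where
  open ≡-Reasoning
  j≤n : j ≤ n
  j≤n = ≤-pred (≤∧≢⇒< j≤1+n j≢1+n)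
  new = replicate (e (suc n)) (suc n * c)
  new∉ : j * c ∉ new
  new∉ x∈ = j≢1+n (*-cancelʳ-≡ j (suc n) c (∈-replicate⁻ x∈))

↭-mulList-count : ∀ {n xs} → All (InRange n) xs → xs ↭ mulList 1 n (λ j → count j xs)
↭-mulList-count {n} {xs} xs⊆[1,n] = ↭-by-count same
  where
  e = λ j → count j xs
  ms⊆[1,n] : ∀ {x} → x ∈ mulList 1 n e → InRange n x
  ms⊆[1,n] x∈ with ∈-mulList⁻ {c = 1} {n} {e} x∈
  ... | j , j∈[1,n] , refl = subst (InRange n) (sym (*-identityʳ j)) j∈[1,n]
  same : ∀ x → count x xs ≡ count x (mulList 1 n e)
  same x with (1 ≤? x) ×-dec (x ≤? n)
  ... | yes x∈[1,n] = sym (subst (λ y → count y (mulList 1 n e) ≡ e x) (*-identityʳ x) (count-mulList e x∈[1,n]))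
  ... | no x∉[1,n]  = trans (count-∉ (x∉[1,n] ∘ All.lookup xs⊆[1,n])) (sym (count-∉ (x∉[1,n] ∘ ms⊆[1,n])))

AllPairs-mapWithAll : ∀ {A : Set} {P : A → Set} {R S : A → A → Set} →
  (∀ {x y} → P x → P y → R x y → S x y) → ∀ {xs} → All P xs → AllPairs R xs → AllPairs S xs
AllPairs-mapWithAll f []         []         = []
AllPairs-mapWithAll f (px ∷ pxs) (rx ∷ rxs) =
  All.zipWith (λ (py , r) → f px py r) (pxs , rx) ∷ AllPairs-mapWithAll f pxs rxs

sum-map-+ : ∀ {A : Set} (f g : A → ℕ) xs → sum (map (λ x → f x + g x) xs) ≡ sum (map f xs) + sum (map g xs)
sum-map-+ f g []       = refl
sum-map-+ f g (x ∷ xs) =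
  trans (cong (f x + g x +_) (sum-map-+ f g xs)) (interchange (f x) (g x) (sum (map f xs)) (sum (map g xs)))

sum-map-0 : ∀ {A : Set} {f : A → ℕ} → (∀ x → f x ≡ 0) → ∀ xs → sum (map f xs) ≡ 0
sum-map-0 f≡0 []       = refl
sum-map-0 f≡0 (x ∷ xs) = cong₂ _+_ (f≡0 x) (sum-map-0 f≡0 xs)

sumBelow : ℕ → (ℕ → ℕ) → ℕ
sumBelow c f = sum (map (λ i → f (toℕ i)) (allFin c))

sumBelow-suc : ∀ c f → sumBelow (suc c) f ≡ f 0 + sumBelow c (f ∘ suc)
sumBelow-suc c f = cong (λ xs → f 0 + sum xs) (trans
  (map-tabulate {n = c} Fin.suc (λ i → f (toℕ i)))
  (sym (map-tabulate {n = c} (λ i → i) (λ i → f (suc (toℕ i))))))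

sumBelow-single : ∀ {c k} (f : ℕ → ℕ) → k < c → (∀ r → r ≢ k → f r ≡ 0) → sumBelow c f ≡ f k
sumBelow-single {suc c} {zero} f _ f≡0 = begin
  sumBelow (suc c) f        ≡⟨ sumBelow-suc c f ⟩
  f 0 + sumBelow c (f ∘ suc) ≡⟨ cong (f 0 +_) (sum-map-0 (λ i → f≡0 (suc (toℕ i)) λ ()) (allFin c)) ⟩
  f 0 + 0                   ≡⟨ +-identityʳ (f 0) ⟩
  f 0                       ∎
  where open ≡-Reasoning
sumBelow-single {suc c} {suc k} f (s≤s k<c) f≡0 = trans (sumBelow-suc c f)
  (cong₂ _+_ (f≡0 0 λ ()) (sumBelow-single (f ∘ suc) k<c λ r r≢k → f≡0 (suc r) (r≢k ∘ suc-injective)))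

sum-partition : ∀ {A : Set} {c} (key : A → ℕ) → (∀ x → key x < c) → (g : A → ℕ) → ∀ xs →
  sum (map g xs) ≡ sumBelow c (λ r → sum (map g (filter (λ x → key x ≟ r) xs)))
sum-partition {c = c} key key<c g []       = sym (sum-map-0 (λ _ → refl) (allFin c))
sum-partition {c = c} key key<c g (x ∷ xs) = begin
  g x + sum (map g xs)                           ≡⟨ cong₂ _+_ part[x]-sum (sum-partition key key<c g xs) ⟩
  sumBelow c (part [ x ]) + sumBelow c (part xs) ≡⟨ sum-map-+ (part [ x ] ∘ toℕ) (part xs ∘ toℕ) (allFin c) ⟨
  sumBelow c (λ r → part [ x ] r + part xs r)    ≡⟨ cong sum (map-cong (part-∷ ∘ toℕ) (allFin c)) ⟩
  sumBelow c (part (x ∷ xs))                     ∎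
  where
  open ≡-Reasoning
  part : List _ → ℕ → ℕ
  part ys r = sum (map g (filter (λ y → key y ≟ r) ys))
  part[x]-sum : g x ≡ sumBelow c (part [ x ])
  part[x]-sum = sym (trans
    (sumBelow-single (part [ x ]) (key<c x) λ r r≢key →
      cong (sum ∘ map g) (filter-reject (λ y → key y ≟ r) (r≢key ∘ sym)))
    (trans (cong (sum ∘ map g) (filter-accept (λ y → key y ≟ key x) refl)) (+-identityʳ (g x))))
  part-∷ : ∀ r → part [ x ] r + part xs r ≡ part (x ∷ xs) r
  part-∷ r = begin
    sum (map g (filter P? [ x ])) + sum (map g (filter P? xs)) ≡⟨ sum-++ (map g (filter P? [ x ])) _ ⟨
    sum (map g (filter P? [ x ]) ++ map g (filter P? xs))      ≡⟨ cong sum (map-++ g (filter P? [ x ]) _) ⟨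
    sum (map g (filter P? [ x ] ++ filter P? xs))              ≡⟨ cong (sum ∘ map g) (filter-++ P? [ x ] xs) ⟨
    sum (map g (filter P? (x ∷ xs)))                           ∎
    where
    P? = λ y → key y ≟ r

module _ (c : ℕ) .{{_ : NonZero c}} where

  contract : Edge → Edge
  contract (u , w) = u / c , w / c

  inClass? : ∀ r (e : Edge) → Dec (proj₁ e % c ≡ r)
  inClass? r e = proj₁ e % c ≟ r

  ≤⇒∣-∣≡*⇒%≡ : ∀ {u w} k → u ≤ w → ∣ u - w ∣ ≡ k * c → u % c ≡ w % c
  ≤⇒∣-∣≡*⇒%≡ {u} {w} k u≤w eq = begin
    u % c             ≡⟨ [m+kn]%n≡m%n u k c ⟨
    (u + k * c) % c   ≡⟨ cong (λ d → (u + d) % c) (trans (sym eq) (m≤n⇒∣m-n∣≡n∸m u≤w)) ⟩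
    (u + (w ∸ u)) % c ≡⟨ cong (_% c) (m+[n∸m]≡n u≤w) ⟩
    w % c             ∎
    where open ≡-Reasoning

  ∣-∣≡*⇒%≡ : ∀ {u w} k → ∣ u - w ∣ ≡ k * c → u % c ≡ w % c
  ∣-∣≡*⇒%≡ {u} {w} k eq with ≤-total u w
  ... | inj₁ u≤w = ≤⇒∣-∣≡*⇒%≡ k u≤w eq
  ... | inj₂ w≤u = sym (≤⇒∣-∣≡*⇒%≡ k w≤u (trans (∣-∣-comm w u) eq))

  ℓ≡*⇒%≡ : ∀ {m u w j} → u < m * c → w < m * c → ℓ (m * c) (u , w) ≡ j * c → u % c ≡ w % c
  ℓ≡*⇒%≡ {m} {u} {w} {j} u<mc w<mc eq with ⊓-sel ∣ u - w ∣ (m * c ∸ ∣ u - w ∣)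
  ... | inj₁ ℓ≡d     = ∣-∣≡*⇒%≡ j (trans (sym ℓ≡d) eq)
  ... | inj₂ ℓ≡mc∸d = ∣-∣≡*⇒%≡ (m ∸ j) (begin
    ∣ u - w ∣                   ≡⟨ m∸[m∸n]≡n d≤mc ⟨
    m * c ∸ (m * c ∸ ∣ u - w ∣) ≡⟨ cong (m * c ∸_) (trans (sym ℓ≡mc∸d) eq) ⟩
    m * c ∸ j * c               ≡⟨ *-distribʳ-∸ c m j ⟨
    (m ∸ j) * c                 ∎)
    where
    open ≡-Reasoning
    d≤mc : ∣ u - w ∣ ≤ m * c
    d≤mc = ≤-trans (∣m-n∣≤m⊔n u w) (⊔-lub (<⇒≤ u<mc) (<⇒≤ w<mc))

  ℓ-contract : ∀ m {u w} → u % c ≡ w % c → ℓ (m * c) (u , w) ≡ ℓ m (contract (u , w)) * c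
  ℓ-contract m {u} {w} u≡w = begin
    ∣ u - w ∣ ⊓ (m * c ∸ ∣ u - w ∣) ≡⟨ cong (λ d → d ⊓ (m * c ∸ d)) d≡Dc ⟩
    D * c ⊓ (m * c ∸ D * c)         ≡⟨ cong (D * c ⊓_) (*-distribʳ-∸ c m D) ⟨
    D * c ⊓ ((m ∸ D) * c)           ≡⟨ *-distribʳ-⊓ c D (m ∸ D) ⟨
    (D ⊓ (m ∸ D)) * c               ∎
    where
    open ≡-Reasoning
    D = ∣ u / c - w / c ∣
    d≡Dc : ∣ u - w ∣ ≡ D * c
    d≡Dc = begin
      ∣ u - w ∣                                 ≡⟨ cong₂ ∣_-_∣ (m≡m%n+[m/n]*n u c) w≡ ⟩
      ∣ u % c + u / c * c - u % c + w / c * c ∣ ≡⟨ ∣m+n-m+o∣≡∣n-o∣ (u % c) _ _ ⟩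
      ∣ u / c * c - w / c * c ∣                 ≡⟨ *-distribʳ-∣-∣ c (u / c) (w / c) ⟨
      D * c                                     ∎
      where
      w≡ : w ≡ u % c + w / c * c
      w≡ = trans (m≡m%n+[m/n]*n w c) (cong (_+ w / c * c) (sym u≡w))

  %-/-injective : ∀ {u u′} → u % c ≡ u′ % c → u / c ≡ u′ / c → u ≡ u′
  %-/-injective {u} {u′} %≡ /≡ =
    trans (m≡m%n+[m/n]*n u c) (trans (cong₂ (λ r q → r + q * c) %≡ /≡) (sym (m≡m%n+[m/n]*n u′ c)))

  [r+x*c]%c≡r : ∀ {r} x → r < c → (r + x * c) % c ≡ r
  [r+x*c]%c≡r {r} x r<c = trans ([m+kn]%n≡m%n r x c) (m<n⇒m%n≡m r<c)

  [r+x*c]/c≡x : ∀ {r} x → r < c → (r + x * c) / c ≡ x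
  [r+x*c]/c≡x {r} x r<c = trans (+-distrib-/-∣ʳ r (n∣m*n x)) (cong₂ _+_ (m<n⇒m/n≡0 r<c) (m*n/n≡m x c))

  ∈ₑ-contract : ∀ {y e} → y ∈ₑ e → (y / c) ∈ₑ contract e
  ∈ₑ-contract = Sum.map (cong (_/ c)) (cong (_/ c))

  contract-∈ₑ⁻ : ∀ {x} e → x ∈ₑ contract e → ∃[ y ] (y ∈ₑ e × y / c ≡ x)
  contract-∈ₑ⁻ (u , w) (inj₁ x≡u/c) = u , inj₁ refl , sym x≡u/c
  contract-∈ₑ⁻ (u , w) (inj₂ x≡w/c) = w , inj₂ refl , sym x≡w/c

  ∈ₑ-%≡ : ∀ {y u w} → y ∈ₑ (u , w) → u % c ≡ w % c → y % c ≡ u % c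
  ∈ₑ-%≡ (inj₁ refl) _   = refl
  ∈ₑ-%≡ (inj₂ refl) u≡w = sym u≡w

  module _ (n : ℕ) where

    Admissible : Edge → Set
    Admissible e = IsEdge (2 * n * c) e × proj₁ e % c ≡ proj₂ e % c × InRange n (ℓ (2 * n) (contract e))

    admissible : ∀ {F b} → All (IsEdge (2 * n * c)) F → lengths (2 * n * c) F ↭ mulList c n b →
                 All Admissible F
    admissible edges perm = All.tabulate λ e∈F →
      admissible-edge (All.lookup edges e∈F) (∈-mulList⁻ (∈-resp-↭ perm (∈-map⁺ (ℓ (2 * n * c)) e∈F)))
      where
      admissible-edge : ∀ {e} → IsEdge (2 * n * c) e →
                        ∃[ j ] (InRange n j × ℓ (2 * n * c) e ≡ j * c) → Admissible e
      admissible-edge isEdge@(u<v , w<v , _) (j , j∈[1,n] , ℓ≡jc) = isEdge , ends , ℓ′∈[1,n]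
        where
        ends = ℓ≡*⇒%≡ {m = 2 * n} {j = j} u<v w<v ℓ≡jc
        ℓ′≡j = *-cancelʳ-≡ _ j c (trans (sym (ℓ-contract (2 * n) ends)) ℓ≡jc)
        ℓ′∈[1,n] = subst (InRange n) (sym ℓ′≡j) j∈[1,n]

    classMatching : ℕ → List Edge → List Edge
    classMatching r F = map contract (filter (inClass? r) F)

    classMatching-edges : ∀ r {F} → All Admissible F → All (IsEdge (2 * n)) (classMatching r F)
    classMatching-edges r adm = Allₚ.map⁺ (All.map contract-isEdge (Allₚ.filter⁺ (inClass? r) adm))
      where
      contract-isEdge : ∀ {e} → Admissible e → IsEdge (2 * n) (contract e)
      contract-isEdge ((u<v , w<v , u≢w) , ends , _) =
        m<n*o⇒m/o<n u<v , m<n*o⇒m/o<n w<v , u≢w ∘ %-/-injective ends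

    classMatching-lengths : ∀ r {F} → All Admissible F → All (InRange n) (lengths (2 * n) (classMatching r F))
    classMatching-lengths r adm =
      Allₚ.map⁺ (Allₚ.map⁺ (All.map (proj₂ ∘ proj₂) (Allₚ.filter⁺ (inClass? r) adm)))

    classMatching-disjoint : ∀ r {F} → All Admissible F → AllPairs DisjointEdges F →
                             AllPairs DisjointEdges (classMatching r F)
    classMatching-disjoint r {F} adm pairs = AllPairsₚ.map⁺ (AllPairs-mapWithAll contract-disjoint
      (All.zip (Allₚ.filter⁺ (inClass? r) adm , all-filter (inClass? r) F))
      (AllPairsₚ.filter⁺ (inClass? r) pairs))
      where
      contract-disjoint : ∀ {e e′} → Admissible e × proj₁ e % c ≡ r → Admissible e′ × proj₁ e′ % c ≡ r →
                          DisjointEdges e e′ → DisjointEdges (contract e) (contract e′)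
      contract-disjoint {e} {e′} ((_ , ends , _) , e∈r) ((_ , ends′ , _) , e′∈r) disjoint x x∈ x∈′
        with contract-∈ₑ⁻ e x∈ | contract-∈ₑ⁻ e′ x∈′
      ... | y , y∈e , y/c≡x | y′ , y′∈e′ , y′/c≡x = disjoint y y∈e (subst (_∈ₑ e′) (sym y≡y′) y′∈e′)
        where
        y≡y′ : y ≡ y′
        y≡y′ = %-/-injective (trans (trans (∈ₑ-%≡ y∈e ends) e∈r) (sym (trans (∈ₑ-%≡ y′∈e′ ends′) e′∈r)))
                             (trans y/c≡x (sym y′/c≡x))

    -- The vertex x of K_{2n} is covered because the vertex r + x c of K_{2nc} is.
    classMatching-covers : ∀ {r F} → r < c → All Admissible F →
      (∀ y → y < 2 * n * c → ∃ λ e → e ∈ F × y ∈ₑ e) →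
      ∀ x → x < 2 * n → ∃ λ e → e ∈ classMatching r F × x ∈ₑ e
    classMatching-covers {r} {F} r<c adm cover x x<2n = contracted (cover y y<2nc)
      where
      y = r + x * c
      y<2nc : y < 2 * n * c
      y<2nc = ≤-trans (+-monoˡ-< (x * c) r<c) (*-monoˡ-≤ c x<2n)
      contracted : (∃ λ e → e ∈ F × y ∈ₑ e) → ∃ λ e → e ∈ classMatching r F × x ∈ₑ e
      contracted (e , e∈F , y∈e) =
        contract e , ∈-map⁺ contract (∈-filter⁺ (inClass? r) e∈F e∈r) , x∈contract
        where
        e∈r : proj₁ e % c ≡ r
        e∈r = trans (sym (∈ₑ-%≡ y∈e (proj₁ (proj₂ (All.lookup adm e∈F))))) ([r+x*c]%c≡r x r<c)
        x∈contract : x ∈ₑ contract e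
        x∈contract = subst (_∈ₑ contract e) ([r+x*c]/c≡x x r<c) (∈ₑ-contract y∈e)

    classMatching-isPerfectMatching : ∀ {r F} → r < c → All Admissible F →
      IsPerfectMatching (2 * n * c) F → IsPerfectMatching (2 * n) (classMatching r F)
    classMatching-isPerfectMatching {r} r<c adm (_ , pairs , cover) =
      classMatching-edges r adm , classMatching-disjoint r adm pairs , classMatching-covers r<c adm cover

    count-lengths-classMatching : ∀ j {F} → All Admissible F →
      count (j * c) (lengths (2 * n * c) F) ≡ sumBelow c (λ r → count j (lengths (2 * n) (classMatching r F)))
    count-lengths-classMatching j {F} adm = begin
      count (j * c) (lengths (2 * n * c) F)
        ≡⟨ count-map (j * c) (ℓ (2 * n * c)) F ⟩
      sum (map (δ (j * c) ∘ ℓ (2 * n * c)) F)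
        ≡⟨ cong sum (map-cong-local (All.map scale adm)) ⟩
      sum (map g F)
        ≡⟨ sum-partition (λ e → proj₁ e % c) (λ e → m%n<n (proj₁ e) c) g F ⟩
      sumBelow c (λ r → sum (map g (filter (inClass? r) F)))
        ≡⟨ cong sum (map-cong (sym ∘ contracted) (allFin c)) ⟩
      sumBelow c (λ r → count j (lengths (2 * n) (classMatching r F)))
        ∎
      where
      open ≡-Reasoning
      g = δ j ∘ ℓ (2 * n) ∘ contract
      scale : ∀ {e} → Admissible e → δ (j * c) (ℓ (2 * n * c) e) ≡ g e
      scale (_ , ends , _) = trans (cong (δ (j * c)) (ℓ-contract (2 * n) ends)) (δ-*-cancelʳ c j _)
      contracted : ∀ i →
        count j (lengths (2 * n) (classMatching (toℕ i) F)) ≡ sum (map g (filter (inClass? (toℕ i)) F))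
      contracted i = trans (count-map j (ℓ (2 * n)) (map contract L)) (cong sum (sym (map-∘ L)))
        where L = filter (inClass? (toℕ i)) F

proposition2p6 : (c n : ℕ) → 1 ≤ c → 1 ≤ n → (F : List Edge) → (b : ℕ → ℕ)
    → IsPerfectMatching (2 * n * c) F
    → lengths (2 * n * c) F ↭ mulList c n b
    → Σ (Fin c → List Edge) λ Fs → Σ (Fin c → ℕ → ℕ) λ a →
        ((i : Fin c) → IsPerfectMatching (2 * n) (Fs i) × lengths (2 * n) (Fs i) ↭ mulList 1 n (a i))
        × ((j : ℕ) → 1 ≤ j → j ≤ n → b j ≡ sum (map (λ i → a i j) (allFin c)))
proposition2p6 c n 1≤c _ F b isMatching@(edges , _ , _) perm = Fs , a , matchings , multiplicities
  where
  instance
    c≢0 : NonZero c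
    c≢0 = >-nonZero 1≤c
  adm : All (Admissible c n) F
  adm = admissible c n edges perm
  Fs : Fin c → List Edge
  Fs i = classMatching c n (toℕ i) F
  a : Fin c → ℕ → ℕ
  a i j = count j (lengths (2 * n) (Fs i))
  matchings : ∀ i → IsPerfectMatching (2 * n) (Fs i) × lengths (2 * n) (Fs i) ↭ mulList 1 n (a i)
  matchings i = classMatching-isPerfectMatching c n (toℕ<n i) adm isMatching
              , ↭-mulList-count (classMatching-lengths c n (toℕ i) adm)
  multiplicities : ∀ j → 1 ≤ j → j ≤ n → b j ≡ sum (map (λ i → a i j) (allFin c))
  multiplicities j 1≤j j≤n = begin
    b j                                   ≡⟨ count-mulList b (1≤j , j≤n) ⟨
    count (j * c) (mulList c n b)         ≡⟨ count-↭ perm ⟨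
    count (j * c) (lengths (2 * n * c) F) ≡⟨ count-lengths-classMatching c n j adm ⟩
    sum (map (λ i → a i j) (allFin c))    ∎
    where open ≡-Reasoning
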